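{- Let $k\ge1$ be an integer. For any finite simple graph $G$ of order $n$, $$d_k(G)\le d_R^k(G)\le \frac{2kn}{\min\{n,\gamma_k(G)+k\}}.$$
   Context: A set $S\subseteq V(G)$ is $k$-dominating if every vertex $v\in V(G)\setminus S$ has at least $k$ neighbors in $S$; $\gamma_k(G)$ is the minimum cardinality of a $k$-dominating set. A $k$-domatic partition is a partition of $V(G)$ into $k$-dominating sets, and the $k$-domatic number $d_k(G)$ is the largest number of sets in a $k$-domatic partition. A Roman $k$-dominating function (RkDF) on $G$ is a map $f:V(G)\to\{0,1,2\}$ such that every vertex $v$ with $f(v)=0$ has at least $k$ neighbors $u$ with $f(u)=2$. A set $\{f_1,\ldots,f_d\}$ of pairwise distinct RkDFs on $G$ with $\sum_{i=1}^d f_i(v)\le 2k$ for every $v\in V(G)$ is a Roman $(k,k)$-dominating family on $G$; the maximum number of functions in such a family is the Roman $(k,k)$-domatic number $d_R^k(G)$. -}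

module Defs where

open import Data.Nat using (ℕ; _≤_; _+_; _*_; _⊓_)
import Data.Nat.Properties as ℕP
open import Data.Empty using (⊥)
open import Data.Bool using (Bool; true; false)
open import Data.Fin using (Fin; toℕ)
open import Data.Fin.Subset using (Subset; _∩_; ∣_∣; _∈_; _∉_)
open import Data.Fin.Properties using (_≟_)
open import Data.Vec using (tabulate)
open import Data.List using (map; allFin)
open import Data.Nat.ListAction using (sum)
open import Data.Product using (Σ; _×_; ∃)
open import Relation.Nullary.Decidable using (⌊_⌋)
open import Relation.Binary.PropositionalEquality using (_≡_; _≢_)
open import Function.Definitions using (Surjective)

record Graph (n : ℕ) : Set where
  field
    adj   : Fin n → Fin n → Bool
    sym   : ∀ u v → adj u v ≡ adj v u
    irrefl : ∀ v → adj v v ≡ false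

open Graph public

N : ∀ {n} → Graph n → Fin n → Subset n
N G v = tabulate (adj G v)

nbrsIn : ∀ {n} → Graph n → Subset n → Fin n → ℕ
nbrsIn G S v = ∣ S ∩ N G v ∣

KDominating : ∀ {n} → Graph n → ℕ → Subset n → Set
KDominating G k S = ∀ v → v ∉ S → k ≤ nbrsIn G S v

IsGammaK : ∀ {n} → Graph n → ℕ → ℕ → Set
IsGammaK G k g =
  (Σ (Subset _) λ S → KDominating G k S × ∣ S ∣ ≡ g)
  × (∀ S → KDominating G k S → g ≤ ∣ S ∣)

-- A partition of V(G) into d (nonempty) blocks, given by the block map
-- c : V(G) → Fin d (surjective, so every block is nonempty); block i.
block : ∀ {n d} → (Fin n → Fin d) → Fin d → Subset n
block c i = tabulate (λ v → ⌊ c v ≟ i ⌋)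

KDomaticPartition : ∀ {n} → Graph n → ℕ → (d : ℕ) → (Fin n → Fin d) → Set
KDomaticPartition G k d c = Surjective _≡_ _≡_ c × (∀ i → KDominating G k (block c i))

IsDomaticK : ∀ {n} → Graph n → ℕ → ℕ → Set
IsDomaticK {n} G k m =
  (Σ (Fin n → Fin m) λ c → KDomaticPartition G k m c)
  × (∀ d (c : Fin n → Fin d) → KDomaticPartition G k d c → d ≤ m)

twos : ∀ {n} → (Fin n → Fin 3) → Subset n
twos f = tabulate (λ v → ⌊ ℕP._≟_ (toℕ (f v)) 2 ⌋)

RkDF : ∀ {n} → Graph n → ℕ → (Fin n → Fin 3) → Set
RkDF G k f = ∀ v → toℕ (f v) ≡ 0 → k ≤ nbrsIn G (twos f) v

RomanKKFamily : ∀ {n} → Graph n → ℕ → (d : ℕ) → (Fin d → Fin n → Fin 3) → Set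
RomanKKFamily G k d fs =
  (∀ i → RkDF G k (fs i))
  × (∀ i j → i ≢ j → ((∀ v → fs i v ≡ fs j v) → ⊥))
  × (∀ v → sum (map (λ i → toℕ (fs i v)) (allFin d)) ≤ 2 * k)

IsRomanDomaticK : ∀ {n} → Graph n → ℕ → ℕ → Set
IsRomanDomaticK {n} G k m =
  (Σ (Fin m → Fin n → Fin 3) λ fs → RomanKKFamily G k m fs)
  × (∀ d (fs : Fin d → Fin n → Fin 3) → RomanKKFamily G k d fs → d ≤ m)

module Submission where

-- Proof idea.  Write w(f) = Σ_v f(v) for the weight of a Roman function.
--
-- For a Roman k-dominating function f let
--     V₂ = {v | f v = 2} and V₁₂ = {v | f v ≥ 1}; then w(f) = |V₁₂| + |V₂|
--     and V₁₂ is k-dominating, so |V₁₂| ≥ γ_k.  Either some vertex has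
--     value 0, whence |V₂| ≥ k and w(f) ≥ γ_k + k, or no vertex does and
--     w(f) ≥ n.  In both cases w(f) ≥ min(n, γ_k + k).
-- (2) Upper bound on the total weight.  In a Roman (k,k)-dominating family
--     f₁,…,f_d every vertex carries total value ≤ 2k, so exchanging the two
--     sums gives Σ_i w(f_i) ≤ 2kn.  With (1): d · min(n, γ_k + k) ≤ 2kn.
-- (3) From partitions to families.  If V₁,…,V_d is a k-domatic partition,
--     the functions f_i = 2·[v ∈ V_i] are Roman k-dominating (the 2-set of
--     f_i is V_i), pairwise distinct (blocks are nonempty) and give every
--     vertex total value exactly 2 ≤ 2k; hence d_k ≤ d_R^k.

open import Defs hiding (sym)
open import Data.Nat using (ℕ; zero; suc; z≤n; s≤s; _≤_; _+_; _*_; _⊓_)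
import Data.Nat.Properties as ℕP
open import Data.Nat.ListAction using () renaming (sum to listSum)
open import Data.Bool using (Bool; true; false)
open import Data.Fin using (Fin; toℕ; zero; suc)
open import Data.Fin.Properties using (_≟_)
open import Data.Fin.Subset using (Subset; ∣_∣; _∈_; _∉_; _⊆_)
open import Data.Fin.Subset.Properties using (p⊆q⇒∣p∣≤∣q∣; x∈p∩q⁺; x∈p∩q⁻; p∩q⊆p)
open import Data.Vec using (tabulate)
open import Data.Vec.Properties using (lookup∘tabulate; []=⇒lookup; lookup⇒[]=; tabulate-cong)
import Data.List as List
import Data.List.Properties as List
open import Data.Product using (_×_; _,_)
open import Relation.Nullary.Decidable using (⌊_⌋; yes; no)
open import Relation.Nullary.Negation using (contradiction)
open import Data.Empty using (⊥)
open import Relation.Binary.PropositionalEquality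
open import Function using (_∘_; id)
open import Algebra.Properties.CommutativeMonoid.Sum ℕP.+-0-commutativeMonoid
  using (sum; sum-cong-≗; ∑-distrib-+; ∑-comm)

∑-mono : ∀ {n} {a b : Fin n → ℕ} → (∀ v → a v ≤ b v) → sum a ≤ sum b
∑-mono {zero}  a≤b = z≤n
∑-mono {suc n} a≤b = ℕP.+-mono-≤ (a≤b zero) (∑-mono (a≤b ∘ suc))

∑-const : ∀ n c → sum {n} (λ _ → c) ≡ n * c
∑-const zero    c = refl
∑-const (suc n) c = cong (c +_) (∑-const n c)

listSum-allFin : ∀ d (h : Fin d → ℕ) → listSum (List.map h (List.allFin d)) ≡ sum h
listSum-allFin d h = trans (cong listSum (List.map-tabulate id h)) (listSum-tabulate h)
  where
  listSum-tabulate : ∀ {m} (h : Fin m → ℕ) → listSum (List.tabulate h) ≡ sum h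
  listSum-tabulate {zero}  h = refl
  listSum-tabulate {suc m} h = cong (h zero +_) (listSum-tabulate (h ∘ suc))

indicator : Bool → ℕ
indicator true  = 1
indicator false = 0

∈-tabulate⁻ : ∀ {n} (b : Fin n → Bool) v → v ∈ tabulate b → b v ≡ true
∈-tabulate⁻ b v v∈ = trans (sym (lookup∘tabulate b v)) ([]=⇒lookup v∈)

∈-tabulate⁺ : ∀ {n} (b : Fin n → Bool) v → b v ≡ true → v ∈ tabulate b
∈-tabulate⁺ b v bv = lookup⇒[]= v (tabulate b) (trans (lookup∘tabulate b v) bv)

∣tabulate∣ : ∀ {n} (b : Fin n → Bool) → ∣ tabulate b ∣ ≡ sum (indicator ∘ b)
∣tabulate∣ {zero}  b = refl
∣tabulate∣ {suc n} b with b zero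
... | true  = cong suc (∣tabulate∣ (b ∘ suc))
... | false = ∣tabulate∣ (b ∘ suc)

nbrsIn-mono : ∀ {n} (G : Graph n) {S T : Subset n} v → S ⊆ T → nbrsIn G S v ≤ nbrsIn G T v
nbrsIn-mono G {S} v S⊆T = p⊆q⇒∣p∣≤∣q∣ λ x∈ →
  let (x∈S , x∈N) = x∈p∩q⁻ S (N G v) x∈ in x∈p∩q⁺ (S⊆T x∈S , x∈N)

weight : ∀ {n} → (Fin n → Fin 3) → ℕ
weight f = sum (λ v → toℕ (f v))

-- The tests f v ≥ 1 and f v = 2 (the latter in the form used by twos).
positive : Fin 3 → Bool
positive zero    = false
positive (suc _) = true

isTwo : Fin 3 → Bool
isTwo x = ⌊ toℕ x ℕP.≟ 2 ⌋

value-split : ∀ x → toℕ x ≡ indicator (positive x) + indicator (isTwo x)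
value-split zero             = refl
value-split (suc zero)       = refl
value-split (suc (suc zero)) = refl

support : ∀ {n} → (Fin n → Fin 3) → Subset n
support f = tabulate (positive ∘ f)

weight-split : ∀ {n} (f : Fin n → Fin 3) → weight f ≡ ∣ support f ∣ + ∣ twos f ∣
weight-split f = begin
  sum (λ v → toℕ (f v))
    ≡⟨ sum-cong-≗ (value-split ∘ f) ⟩
  sum (λ v → indicator (positive (f v)) + indicator (isTwo (f v)))
    ≡⟨ ∑-distrib-+ (indicator ∘ positive ∘ f) (indicator ∘ isTwo ∘ f) ⟩
  sum (indicator ∘ positive ∘ f) + sum (indicator ∘ isTwo ∘ f)
    ≡⟨ sym (cong₂ _+_ (∣tabulate∣ (positive ∘ f)) (∣tabulate∣ (isTwo ∘ f))) ⟩
  ∣ support f ∣ + ∣ twos f ∣ ∎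
  where open ≡-Reasoning

twos⊆support : ∀ {n} (f : Fin n → Fin 3) → twos f ⊆ support f
twos⊆support f {v} v∈ = ∈-tabulate⁺ _ v (two-positive (f v) (∈-tabulate⁻ _ v v∈))
  where
  two-positive : ∀ x → isTwo x ≡ true → positive x ≡ true
  two-positive (suc x) _ = refl

∉support⇒zero : ∀ {n} (f : Fin n → Fin 3) v → v ∉ support f → toℕ (f v) ≡ 0
∉support⇒zero f v v∉ with f v in fv
... | zero  = refl
... | suc _ = contradiction (∈-tabulate⁺ _ v (cong positive fv)) v∉

support-kDominating : ∀ {n} (G : Graph n) k f → RkDF G k f → KDominating G k (support f)
support-kDominating G k f isRkDF v v∉ =
  ℕP.≤-trans (isRkDF v (∉support⇒zero f v v∉)) (nbrsIn-mono G v (twos⊆support f))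

zero⇒k≤∣twos∣ : ∀ {n} (G : Graph n) k f → RkDF G k f → ∀ v → toℕ (f v) ≡ 0 → k ≤ ∣ twos f ∣
zero⇒k≤∣twos∣ G k f isRkDF v fv≡0 =
  ℕP.≤-trans (isRkDF v fv≡0) (p⊆q⇒∣p∣≤∣q∣ (p∩q⊆p (twos f) (N G v)))

-- Either |V₂| ≥ k, and then w(f) = |V₁₂| + |V₂| ≥ γ_k + k, or every vertex
-- has positive value and w(f) ≥ n.
weight-lower-bound : ∀ {n} (G : Graph n) k g f → IsGammaK G k g → RkDF G k f →
  n ⊓ (g + k) ≤ weight f
weight-lower-bound {n} G k g f (_ , γ-minimal) isRkDF with k ℕP.≤? ∣ twos f ∣
... | yes k≤∣V₂∣ = ℕP.≤-trans (ℕP.m⊓n≤n n (g + k)) (begin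
  g + k                       ≤⟨ ℕP.+-mono-≤ g≤∣V₁₂∣ k≤∣V₂∣ ⟩
  ∣ support f ∣ + ∣ twos f ∣  ≡⟨ sym (weight-split f) ⟩
  weight f                    ∎)
  where
  open ℕP.≤-Reasoning
  g≤∣V₁₂∣ : g ≤ ∣ support f ∣
  g≤∣V₁₂∣ = γ-minimal (support f) (support-kDominating G k f isRkDF)
... | no k≰∣V₂∣ = ℕP.≤-trans (ℕP.m⊓n≤m n (g + k)) (begin
  n                 ≡⟨ sym (ℕP.*-identityʳ n) ⟩
  n * 1             ≡⟨ sym (∑-const n 1) ⟩
  sum {n} (λ _ → 1) ≤⟨ ∑-mono everywhere-positive ⟩
  weight f          ∎)
  where
  open ℕP.≤-Reasoning
  everywhere-positive : ∀ v → 1 ≤ toℕ (f v)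
  everywhere-positive v with f v in fv
  ... | suc _ = s≤s z≤n
  ... | zero  = contradiction (zero⇒k≤∣twos∣ G k f isRkDF v (cong toℕ fv)) k≰∣V₂∣

family-total-weight : ∀ {n} (G : Graph n) k d fs → RomanKKFamily G k d fs →
  sum (λ i → weight (fs i)) ≤ 2 * k * n
family-total-weight {n} G k d fs (_ , _ , vertex-load) = begin
  sum (λ i → sum (λ v → toℕ (fs i v)))  ≡⟨ ∑-comm (λ i v → toℕ (fs i v)) ⟩
  sum (λ v → sum (λ i → toℕ (fs i v)))  ≤⟨ ∑-mono load≤2k ⟩
  sum {n} (λ _ → 2 * k)                 ≡⟨ ∑-const n (2 * k) ⟩
  n * (2 * k)                           ≡⟨ ℕP.*-comm n (2 * k) ⟩
  2 * k * n                             ∎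
  where
  open ℕP.≤-Reasoning
  load≤2k : ∀ v → sum (λ i → toℕ (fs i v)) ≤ 2 * k
  load≤2k v = subst (_≤ 2 * k) (listSum-allFin d _) (vertex-load v)

family-size-bound : ∀ {n} (G : Graph n) k g d fs → IsGammaK G k g → RomanKKFamily G k d fs →
  d * (n ⊓ (g + k)) ≤ 2 * k * n
family-size-bound {n} G k g d fs γ family@(isRkDF , _) = begin
  d * (n ⊓ (g + k))           ≡⟨ sym (∑-const d (n ⊓ (g + k))) ⟩
  sum {d} (λ _ → n ⊓ (g + k)) ≤⟨ ∑-mono (λ i → weight-lower-bound G k g (fs i) γ (isRkDF i)) ⟩
  sum (λ i → weight (fs i))   ≤⟨ family-total-weight G k d fs family ⟩
  2 * k * n                   ∎
  where open ℕP.≤-Reasoning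

twoIf : Bool → Fin 3
twoIf true  = suc (suc zero)
twoIf false = zero

blockRoman : ∀ {n d} → (Fin n → Fin d) → Fin d → Fin n → Fin 3
blockRoman c i v = twoIf ⌊ c v ≟ i ⌋

twos-blockRoman : ∀ {n d} (c : Fin n → Fin d) i → twos (blockRoman c i) ≡ block c i
twos-blockRoman c i = tabulate-cong (λ v → isTwo-twoIf ⌊ c v ≟ i ⌋)
  where
  isTwo-twoIf : ∀ b → isTwo (twoIf b) ≡ b
  isTwo-twoIf true  = refl
  isTwo-twoIf false = refl

-- Each vertex lies in exactly one block, so it receives total value 2.
blockRoman-load : ∀ {d} (j : Fin d) → sum (λ i → toℕ (twoIf ⌊ j ≟ i ⌋)) ≡ 2
blockRoman-load {suc d} zero    = cong (2 +_) (trans (∑-const d 0) (ℕP.*-zeroʳ d))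
blockRoman-load {suc d} (suc j) = trans (sum-cong-≗ shift) (blockRoman-load j)
  where
  shift : ∀ (i : Fin d) → toℕ (twoIf ⌊ suc j ≟ suc i ⌋) ≡ toℕ (twoIf ⌊ j ≟ i ⌋)
  shift i with j ≟ i
  ... | yes _ = refl
  ... | no _  = refl

-- The characteristic functions of a k-domatic partition form a Roman
-- (k,k)-dominating family of the same size (needs k ≥ 1 for the load 2 ≤ 2k).
partition⇒romanFamily : ∀ {n} (G : Graph n) k → 1 ≤ k → ∀ d (c : Fin n → Fin d) →
  KDomaticPartition G k d c → RomanKKFamily G k d (blockRoman c)
partition⇒romanFamily G k 1≤k d c (surjective , blocks-dominate) =
  isRkDF , distinct , load
  where
  isRkDF : ∀ i → RkDF G k (blockRoman c i)
  isRkDF i v value≡0 = subst (λ X → k ≤ nbrsIn G X v) (sym (twos-blockRoman c i))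
    (blocks-dominate i v (λ v∈ → twoIf-zero⇒false _ value≡0 (∈-tabulate⁻ _ v v∈)))
    where
    twoIf-zero⇒false : ∀ b → toℕ (twoIf b) ≡ 0 → b ≢ true
    twoIf-zero⇒false false _ = λ ()
  -- a vertex v of the (nonempty) block V_i gets value 2 from f_i only
  distinct : ∀ i j → i ≢ j → (∀ v → blockRoman c i v ≡ blockRoman c j v) → ⊥
  distinct i j i≢j same with surjective i
  ... | (v , cv≡i) = compare (c v ≟ i) (c v ≟ j) (same v)
    where
    compare : ∀ p q → twoIf ⌊ p ⌋ ≡ twoIf ⌊ q ⌋ → ⊥
    compare (yes _)    (yes cv≡j) _  = i≢j (trans (sym (cv≡i refl)) cv≡j)
    compare (no cv≢i)  _          _  = cv≢i (cv≡i refl)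
    compare (yes _)    (no _)     ()
  load : ∀ v → listSum (List.map (λ i → toℕ (blockRoman c i v)) (List.allFin d)) ≤ 2 * k
  load v = subst (_≤ 2 * k) (sym (trans (listSum-allFin d _) (blockRoman-load (c v))))
    (ℕP.*-monoʳ-≤ 2 1≤k)

corollary3 : (k : ℕ) → 1 ≤ k → (n : ℕ) → (G : Graph n)
    → (g dk dRk : ℕ) → IsGammaK G k g → IsDomaticK G k dk → IsRomanDomaticK G k dRk
    → dk ≤ dRk × dRk * (n ⊓ (g + k)) ≤ 2 * k * n
corollary3 k 1≤k n G g dk dRk γ ((c , partition) , _) ((fs , family) , dRk-maximal) =
  dRk-maximal dk (blockRoman c) (partition⇒romanFamily G k 1≤k dk c partition) ,
  family-size-bound G k g dRk fs γ family
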